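{- For any CSS $\langle\mathcal F_f,\mathcal C\rangle$ in which $\mathcal F_f$ is finite (and $\mathcal C$ is an arbitrary, possibly infinite, set of constraints), there exists a finite $\mathcal C_f\subseteq\mathcal C$ such that $\langle\mathcal F_f,\mathcal C_f\rangle$ is a CSS.
   Context: Fix a finite set $A$ of agents and a finite set $Res$ of resources containing $e$. Let $\Lambda_r$ be a finite set of constants with $|\Lambda_r|=|Res|-1$, and $\gamma_r=\Lambda_r\cup\{c_1,c_2,\dots\}$ a countably infinite set of constants. A (resource) label is a finite multiset over $\gamma_r$, written as a word with letter order ignored; $xy$ denotes multiset union and $\epsilon$ the empty label. A resource constraint is an expression $x\approx y$ and an agent constraint an expression $x\asymp_u y$ ($u\in A$), with $x,y$ labels. For a set $\mathcal C$ of constraints, its closure $\overline{\mathcal C}$ is the least superset of $\mathcal C$ closed under the rules: $\epsilon\approx\epsilon$; $x\approx y\Rightarrow y\approx x$; $xy\approx xy\Rightarrow x\approx x$; $x\approx y,\ y\approx z\Rightarrow x\approx z$; $x\approx y,\ yk\approx yk\Rightarrow xk\approx yk$; $x\asymp_u y\Rightarrow x\approx x$; $x\approx x\Rightarrow x\asymp_v x$ (for every $v\in A$); $x\asymp_u y\Rightarrow y\asymp_u x$; $x\asymp_u y,\ y\asymp_u z\Rightarrow x\asymp_u z$; $x\asymp_u y,\ x\approx k\Rightarrow k\asymp_u y$. A labelled formula is a triple $(S,\phi,x)$ with $S\in\{\mathbb T,\mathbb F\}$, $\phi$ a formula and $x$ a label. A constrained set of statements (CSS) is a pair $\langle\mathcal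 F,\mathcal C\rangle$ with $\mathcal F$ a set of labelled formulae and $\mathcal C$ a set of constraints such that whenever $(S,\phi,x)\in\mathcal F$, we have $x\approx x\in\overline{\mathcal C}$. -}

module Defs where

open import Data.Nat using (ℕ)
open import Data.Fin using (Fin)
open import Data.Sum using (_⊎_)
open import Data.List using (List; []; _++_)
open import Data.List.Membership.Propositional using (_∈_)
open import Data.List.Relation.Binary.Permutation.Propositional using (_↭_)

data Sign : Set where
  𝕋 𝔽 : Sign

-- Everything is parametrised by
--   nA : the number of agents  (A = Fin nA),
--   r  : |Res| - 1             (Res = Fin (suc r) contains e, Λ_r = Fin r),
-- so that γ_r = Λ_r ∪ {c₁, c₂, …} is represented by Fin r ⊎ ℕ.
module Setup (nA r : ℕ) where

  Agent : Set
  Agent = Fin nA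

  Const : Set
  Const = Fin r ⊎ ℕ

  -- A label is a finite multiset over γ_r, represented by a list; two lists
  -- denote the same label iff they are permutations of each other (_↭_).
  -- Multiset union xy is list concatenation x ++ y; ε is [].
  Label : Set
  Label = List Const

  data Constraint : Set where
    _≈_   : Label → Label → Constraint
    _≍[_]_ : Label → Agent → Label → Constraint

  data _≅_ : Constraint → Constraint → Set where
    res≅ : ∀ {x x′ y y′} → x ↭ x′ → y ↭ y′ → (x ≈ y) ≅ (x′ ≈ y′)
    ag≅  : ∀ {x x′ y y′ u} → x ↭ x′ → y ↭ y′ → (x ≍[ u ] y) ≅ (x′ ≍[ u ] y′)

  -- The rule `perm` makes the closure a set of constraints between multisets
  -- (i.e. invariant under the representation of labels).
  data Cl (C : Constraint → Set) : Constraint → Set where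
    base  : ∀ {c} → C c → Cl C c
    perm  : ∀ {c c′} → Cl C c → c ≅ c′ → Cl C c′
    ε≈ε   : Cl C ([] ≈ [])
    symm  : ∀ {x y} → Cl C (x ≈ y) → Cl C (y ≈ x)
    split : ∀ {x y} → Cl C ((x ++ y) ≈ (x ++ y)) → Cl C (x ≈ x)
    trans : ∀ {x y z} → Cl C (x ≈ y) → Cl C (y ≈ z) → Cl C (x ≈ z)
    comp  : ∀ {x y k} → Cl C (x ≈ y) → Cl C ((y ++ k) ≈ (y ++ k))
          → Cl C ((x ++ k) ≈ (y ++ k))
    ag-res  : ∀ {x y u} → Cl C (x ≍[ u ] y) → Cl C (x ≈ x)
    res-ag  : ∀ {x} (v : Agent) → Cl C (x ≈ x) → Cl C (x ≍[ v ] x)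
    ag-symm : ∀ {x y u} → Cl C (x ≍[ u ] y) → Cl C (y ≍[ u ] x)
    ag-trans : ∀ {x y z u} → Cl C (x ≍[ u ] y) → Cl C (y ≍[ u ] z)
             → Cl C (x ≍[ u ] z)
    ag-subst : ∀ {x y k u} → Cl C (x ≍[ u ] y) → Cl C (x ≈ k)
             → Cl C (k ≍[ u ] y)

  record LFormula (Φ : Set) : Set where
    constructor ⟨_,_,_⟩
    field
      sign    : Sign
      formula : Φ
      label   : Label
  open LFormula public

  IsCSS : {Φ : Set} → List (LFormula Φ) → (Constraint → Set) → Set
  IsCSS F C = ∀ {lf} → lf ∈ F → Cl C (label lf ≈ label lf)

  ⟦_⟧ : List Constraint → Constraint → Set
  ⟦ Cf ⟧ c = c ∈ Cf

-- The closure Cl C is inductively generated, so every derivation of a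
-- constraint is a finite tree whose leaves use only finitely many members
-- of C.  Collecting those leaves gives a finite list Cf ⊆ C from which the
-- same constraint is already derivable ("the closure is compact").
module Submission where

open import Defs
open import Data.Nat using (ℕ)
open import Data.List using (List; []; _∷_; _++_)
open import Data.List.Relation.Unary.All using (All; []; _∷_)
open import Data.List.Relation.Unary.All.Properties using (++⁺)
open import Data.List.Membership.Propositional using (_∈_)
open import Data.List.Membership.Propositional.Properties using (∈-++⁺ˡ; ∈-++⁺ʳ)
open import Data.List.Relation.Unary.Any using (here; there)
open import Data.Product using (Σ; _×_; _,_)
open import Relation.Binary.PropositionalEquality using (refl)

module Compactness (nA r : ℕ) where
  open Setup nA r

  Cl-mono : ∀ {P Q : Constraint → Set} → (∀ {c} → P c → Q c) →
            ∀ {c} → Cl P c → Cl Q c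
  Cl-mono P⊆Q (base p)         = base (P⊆Q p)
  Cl-mono P⊆Q (perm d e)       = perm (Cl-mono P⊆Q d) e
  Cl-mono P⊆Q ε≈ε              = ε≈ε
  Cl-mono P⊆Q (symm d)         = symm (Cl-mono P⊆Q d)
  Cl-mono P⊆Q (split d)        = split (Cl-mono P⊆Q d)
  Cl-mono P⊆Q (trans d e)      = trans (Cl-mono P⊆Q d) (Cl-mono P⊆Q e)
  Cl-mono P⊆Q (comp d e)       = comp (Cl-mono P⊆Q d) (Cl-mono P⊆Q e)
  Cl-mono P⊆Q (ag-res d)       = ag-res (Cl-mono P⊆Q d)
  Cl-mono P⊆Q (res-ag v d)     = res-ag v (Cl-mono P⊆Q d)
  Cl-mono P⊆Q (ag-symm d)      = ag-symm (Cl-mono P⊆Q d)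
  Cl-mono P⊆Q (ag-trans d e)   = ag-trans (Cl-mono P⊆Q d) (Cl-mono P⊆Q e)
  Cl-mono P⊆Q (ag-subst d e)   = ag-subst (Cl-mono P⊆Q d) (Cl-mono P⊆Q e)

  weakenˡ : ∀ {c} (Cf Cf′ : List Constraint) → Cl ⟦ Cf ⟧ c → Cl ⟦ Cf ++ Cf′ ⟧ c
  weakenˡ Cf Cf′ = Cl-mono ∈-++⁺ˡ

  weakenʳ : ∀ {c} (Cf Cf′ : List Constraint) → Cl ⟦ Cf′ ⟧ c → Cl ⟦ Cf ++ Cf′ ⟧ c
  weakenʳ Cf Cf′ = Cl-mono (∈-++⁺ʳ Cf)

  FinitelyDerivable : (Constraint → Set) → Constraint → Set
  FinitelyDerivable C c = Σ (List Constraint) λ Cf → All C Cf × Cl ⟦ Cf ⟧ c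

  Rule₁ : Constraint → Constraint → Set₁
  Rule₁ a c = ∀ {P} → Cl P a → Cl P c

  Rule₂ : Constraint → Constraint → Constraint → Set₁
  Rule₂ a b c = ∀ {P} → Cl P a → Cl P b → Cl P c

  apply₁ : ∀ {C a c} → Rule₁ a c →
           FinitelyDerivable C a → FinitelyDerivable C c
  apply₁ rule (Cf , Cf⊆C , d) = Cf , Cf⊆C , rule d

  apply₂ : ∀ {C a b c} → Rule₂ a b c →
           FinitelyDerivable C a → FinitelyDerivable C b → FinitelyDerivable C c
  apply₂ rule (Cf , Cf⊆C , d) (Cf′ , Cf′⊆C , d′) =
    Cf ++ Cf′ , ++⁺ Cf⊆C Cf′⊆C , rule (weakenˡ Cf Cf′ d) (weakenʳ Cf Cf′ d′)

  Cl-compact : ∀ {C c} → Cl C c → FinitelyDerivable C c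
  Cl-compact (base {c} p)     = c ∷ [] , p ∷ [] , base (here refl)
  Cl-compact (perm d e)       = apply₁ (λ d′ → perm d′ e) (Cl-compact d)
  Cl-compact ε≈ε              = [] , [] , ε≈ε
  Cl-compact (symm d)         = apply₁ symm (Cl-compact d)
  Cl-compact (split d)        = apply₁ split (Cl-compact d)
  Cl-compact (trans d e)      = apply₂ trans (Cl-compact d) (Cl-compact e)
  Cl-compact (comp d e)       = apply₂ comp (Cl-compact d) (Cl-compact e)
  Cl-compact (ag-res d)       = apply₁ ag-res (Cl-compact d)
  Cl-compact (res-ag v d)     = apply₁ (res-ag v) (Cl-compact d)
  Cl-compact (ag-symm d)      = apply₁ ag-symm (Cl-compact d)
  Cl-compact (ag-trans d e)   = apply₂ ag-trans (Cl-compact d) (Cl-compact e)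
  Cl-compact (ag-subst d e)   = apply₂ ag-subst (Cl-compact d) (Cl-compact e)

  Cl-compact-family : ∀ {X : Set} (f : X → Constraint) (C : Constraint → Set)
    (xs : List X) → (∀ {x} → x ∈ xs → Cl C (f x)) →
    Σ (List Constraint) λ Cf → All C Cf × (∀ {x} → x ∈ xs → Cl ⟦ Cf ⟧ (f x))
  Cl-compact-family f C [] derivable = [] , [] , λ ()
  Cl-compact-family f C (x ∷ xs) derivable
    with Cl-compact (derivable (here refl))
       | Cl-compact-family f C xs (λ x∈xs → derivable (there x∈xs))
  ... | Cf , Cf⊆C , dx | Cf′ , Cf′⊆C , dxs =
    Cf ++ Cf′ , ++⁺ Cf⊆C Cf′⊆C , derives
    where
    derives : ∀ {y} → y ∈ x ∷ xs → Cl ⟦ Cf ++ Cf′ ⟧ (f y)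
    derives (here refl)  = weakenˡ Cf Cf′ dx
    derives (there y∈xs) = weakenʳ Cf Cf′ (dxs y∈xs)

-- Being a CSS asks for the finitely many constraints x ≈ x, x a label of
-- Ff, to lie in the closure; compactness provides the finite Cf.
proposition6 : (nA r : ℕ) (Φ : Set) (Ff : List (Setup.LFormula nA r Φ))
    (C : Setup.Constraint nA r → Set) →
    Setup.IsCSS nA r Ff C →
    Σ (List (Setup.Constraint nA r)) (λ Cf →
    All C Cf × Setup.IsCSS nA r Ff (Setup.⟦_⟧ nA r Cf))
proposition6 nA r Φ Ff C isCSS =
  Cl-compact-family (λ lf → label lf ≈ label lf) C Ff isCSS
  where
  open Setup nA r
  open Compactness nA r
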